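{- Every cyclic composition of a positive integer $n$ has exactly one odd term if $n$ is odd, and exactly two odd terms if $n$ is even.
   Context: A composition of $n$ is a tuple $(a_1,\ldots,a_k)$ of positive integers with sum $n$. Its associated reverse layered permutation is, in one-line notation, $(n-a_1+1)\cdots(n)\,(n-a_1-a_2+1)\cdots(n-a_1)\cdots(1)\cdots(a_k)$ (values split into consecutive blocks of sizes $a_1,\ldots,a_k$, blocks in decreasing order of values, each block increasing); equivalently it is the unique permutation avoiding $132$ and $213$ with these layer lengths. The composition is cyclic if this permutation consists of a single $n$-cycle. -}

module Defs where

open import Data.Nat using (ℕ; zero; suc; _+_; _∸_; _≤_; _≤?_; _%_)
open import Data.Nat.Properties using (_≟_)
open import Data.List using (List; []; _∷_; length; filter)
open import Data.Product using (∃)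
open import Relation.Nullary using (yes; no)
open import Relation.Binary.PropositionalEquality using (_≡_)

iter : (ℕ → ℕ) → ℕ → ℕ → ℕ
iter f zero    x = x
iter f (suc k) x = f (iter f k x)

-- revLayered n (a₁ ∷ … ∷ aₖ) p : the value at position p (1-indexed) of the
-- reverse layered permutation of the composition (a₁,…,aₖ) of n.
revLayered : ℕ → List ℕ → ℕ → ℕ
revLayered n []       p = p
revLayered n (a ∷ as) p with p ≤? a
... | yes _ = (n ∸ a) + p
... | no  _ = revLayered (n ∸ a) as (p ∸ a)

-- Cyclic: the reverse layered permutation is a single n-cycle, i.e. the
-- orbit of 1 under it contains every element of {1,…,n}.
Cyclic : ℕ → List ℕ → Set
Cyclic n c = ∀ j → 1 ≤ j → j ≤ n → ∃ λ k → iter (revLayered n c) k 1 ≡ j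

oddCount : List ℕ → ℕ
oddCount c = length (filter (λ a → a % 2 ≟ 1) c)

module Submission where

-- Let c = (a₁,…,aₖ) be a composition of n, f its reverse layered
-- permutation and B the permutation reversing every block in place
-- (position p of a block of length a goes to a + 1 - p).  Then
-- f p + B p = n + 1, i.e. f = R ∘ B with R the reversal p ↦ n + 1 - p.
-- Since R and B are involutions, B f B = f⁻¹.
--
-- The fixed points of B are exactly the midpoints of the odd blocks, so B has
-- at least oddCount c fixed points, and every fixed point lies in an odd block.
-- If f is an n-cycle with orbit xₖ = fᵏ 1 and B 1 = x_c₀, then
-- B xₖ = x_(c₀ - k), so xₖ is fixed by B iff 2k ≡ c₀ (mod n).  Two distinct
-- solutions k < n differ by exactly n/2: hence n odd allows at most one fixed
-- point, and no n allows three.  For n even a solution exists unless c₀ is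
-- odd, and then some p satisfies f p = B p, i.e. 2 f p = n + 1, impossible.
-- Together with sum c ≡ oddCount c (mod 2) this gives the theorem.

open import Defs
open import Data.Nat
open import Data.Nat.Properties
open import Data.Nat.DivMod
open import Data.Nat.ListAction using (sum)
open import Data.List using (List; []; _∷_; length; map)
open import Data.List.Properties using (filter-accept; filter-reject; length-map)
open import Data.List.Relation.Unary.All using (All; []; _∷_)
import Data.List.Relation.Unary.All as All
import Data.List.Relation.Unary.All.Properties as All
open import Data.List.Relation.Unary.AllPairs using (AllPairs; []; _∷_)
import Data.List.Relation.Unary.AllPairs as AllPairs
import Data.List.Relation.Unary.AllPairs.Properties as AllPairs
open import Data.Fin using (Fin; toℕ; fromℕ<)
open import Data.Fin.Properties using (pigeonhole; toℕ<n; fromℕ<-injective)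
open import Data.Product using (_×_; _,_; proj₁; proj₂; ∃)
open import Data.Sum using (_⊎_; inj₁; inj₂)
open import Data.Empty using (⊥; ⊥-elim)
open import Relation.Nullary using (¬_; Dec; yes; no)
open import Relation.Nullary.Negation using (contradiction)
open import Relation.Binary.Definitions using (tri<; tri≈; tri>)
open import Relation.Binary.PropositionalEquality
open import Function.Base using (_$_)
open import Algebra.Properties.CommutativeSemigroup +-commutativeSemigroup using (x∙yz≈y∙xz)
open ≡-Reasoning

even-or-odd : ∀ m → m % 2 ≡ 0 ⊎ m % 2 ≡ 1
even-or-odd m with m % 2 | m%n<n m 2
... | 0           | _               = inj₁ refl
... | 1           | _               = inj₂ refl
... | suc (suc _) | s≤s (s≤s ())

halve : ∀ m → ∃ λ k → m ≡ k + k ⊎ m ≡ suc (k + k)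
halve zero = 0 , inj₁ refl
halve (suc m) with halve m
... | k , inj₁ refl = k , inj₂ refl
... | k , inj₂ refl = suc k , inj₁ (cong suc (sym (+-suc k k)))

double≡*2 : ∀ k → k + k ≡ k * 2
double≡*2 k = sym (trans (*-suc k 1) (cong (k +_) (*-identityʳ k)))

double%2 : ∀ k → (k + k) % 2 ≡ 0
double%2 k = trans (cong (_% 2) (double≡*2 k)) (m*n%n≡0 k 2)

suc-%2 : ∀ x y → x % 2 ≡ y % 2 → suc x % 2 ≡ suc y % 2
suc-%2 x y e = begin
  (1 + x) % 2          ≡⟨ %-distribˡ-+ 1 x 2 ⟩
  (1 + x % 2) % 2      ≡⟨ cong (λ r → (1 + r) % 2) e ⟩
  (1 + y % 2) % 2      ≡⟨ %-distribˡ-+ 1 y 2 ⟨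
  (1 + y) % 2          ∎

+-%2 : ∀ a s → (a + s) % 2 ≡ (a % 2 + s) % 2
+-%2 a s = begin
  (a + s) % 2                ≡⟨ %-distribˡ-+ a s 2 ⟩
  (a % 2 + s % 2) % 2        ≡⟨ cong (λ r → (r + s % 2) % 2) (m%n%n≡m%n a 2) ⟨
  (a % 2 % 2 + s % 2) % 2    ≡⟨ %-distribˡ-+ (a % 2) s 2 ⟨
  (a % 2 + s) % 2            ∎

small-odd : ∀ {o} → o ≤ 1 → o % 2 ≡ 1 → o ≡ 1
small-odd {0}           _         ()
small-odd {1}           _         _ = refl
small-odd {suc (suc _)} (s≤s ())  _

small-even : ∀ {o} → 1 ≤ o → o ≤ 2 → o % 2 ≡ 0 → o ≡ 2
small-even {1}                 _ _               ()
small-even {2}                 _ _               _ = refl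
small-even {suc (suc (suc _))} _ (s≤s (s≤s ())) _

suc-even≢double : ∀ {m} k → m % 2 ≡ 0 → suc m ≢ k + k
suc-even≢double {m} k even e =
  0≢1+n (trans (sym (trans (cong (_% 2) e) (double%2 k))) (suc-%2 m 0 even))


oddCount-odd : ∀ a as → a % 2 ≡ 1 → oddCount (a ∷ as) ≡ suc (oddCount as)
oddCount-odd a as odd = cong length (filter-accept (λ a → a % 2 ≟ 1) {a} {as} odd)

oddCount-even : ∀ a as → a % 2 ≡ 0 → oddCount (a ∷ as) ≡ oddCount as
oddCount-even a as even =
  cong length (filter-reject (λ a → a % 2 ≟ 1) {a} {as} (λ odd → 0≢1+n (trans (sym even) odd)))

sum-parity : ∀ c → sum c % 2 ≡ oddCount c % 2
sum-parity [] = refl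
sum-parity (a ∷ as) with even-or-odd a
... | inj₁ even = begin
  (a + sum as) % 2       ≡⟨ +-%2 a (sum as) ⟩
  (a % 2 + sum as) % 2   ≡⟨ cong (λ r → (r + sum as) % 2) even ⟩
  sum as % 2             ≡⟨ sum-parity as ⟩
  oddCount as % 2        ≡⟨ cong (_% 2) (oddCount-even a as even) ⟨
  oddCount (a ∷ as) % 2  ∎
... | inj₂ odd = begin
  (a + sum as) % 2       ≡⟨ +-%2 a (sum as) ⟩
  (a % 2 + sum as) % 2   ≡⟨ cong (λ r → (r + sum as) % 2) odd ⟩
  suc (sum as) % 2       ≡⟨ suc-%2 (sum as) (oddCount as) (sum-parity as) ⟩
  suc (oddCount as) % 2  ≡⟨ cong (_% 2) (oddCount-odd a as odd) ⟨
  oddCount (a ∷ as) % 2  ∎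

odd-decomposition : ∀ {a} → a % 2 ≡ 1 → a ≡ suc (a / 2 + a / 2)
odd-decomposition {a} odd = begin
  a                    ≡⟨ m≡m%n+[m/n]*n a 2 ⟩
  a % 2 + a / 2 * 2    ≡⟨ cong₂ _+_ odd (sym (double≡*2 (a / 2))) ⟩
  suc (a / 2 + a / 2)  ∎


InRange : ℕ → ℕ → Set
InRange n p = 1 ≤ p × p ≤ n

FixedPoint : ℕ → (ℕ → ℕ) → ℕ → Set
FixedPoint n g p = InRange n p × g p ≡ p

blockFlip : List ℕ → ℕ → ℕ
blockFlip []       p = p
blockFlip (a ∷ as) p with p ≤? a
... | yes _ = suc a ∸ p
... | no  _ = a + blockFlip as (p ∸ a)

flip-head : ∀ {a} as {p} → p ≤ a → blockFlip (a ∷ as) p ≡ suc a ∸ p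
flip-head {a} as {p} p≤a with p ≤? a
... | yes _   = refl
... | no  p≰a = contradiction p≤a p≰a

flip-tail : ∀ {a} as {p} → ¬ p ≤ a → blockFlip (a ∷ as) p ≡ a + blockFlip as (p ∸ a)
flip-tail {a} as {p} p≰a with p ≤? a
... | yes p≤a = contradiction p≤a p≰a
... | no  _   = refl

tail-range : ∀ {a S p} → ¬ p ≤ a → p ≤ a + S → InRange S (p ∸ a)
tail-range {a} {S} {p} p≰a p≤a+S =
  m<n⇒0<n∸m (≰⇒> p≰a) , subst (p ∸ a ≤_) (m+n∸m≡n a S) (∸-monoˡ-≤ a p≤a+S)

head-shift : ∀ a {q} → 1 ≤ q → ¬ a + q ≤ a
head-shift a 1≤q = <⇒≱ (m<m+n a 1≤q)

blockFlip-range : ∀ c {p} → InRange (sum c) p → InRange (sum c) (blockFlip c p)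
blockFlip-range []       h = h
blockFlip-range (a ∷ as) {p} (1≤p , p≤n) with p ≤? a
... | yes p≤a = m<n⇒0<n∸m (s≤s p≤a) , ≤-trans (∸-monoʳ-≤ (suc a) 1≤p) (m≤m+n a (sum as))
... | no  p≰a with blockFlip-range as (tail-range p≰a p≤n)
...   | lo , hi = ≤-trans lo (m≤n+m _ a) , +-monoʳ-≤ a hi

blockFlip-involutive : ∀ c {p} → InRange (sum c) p → blockFlip c (blockFlip c p) ≡ p
blockFlip-involutive []       h = refl
blockFlip-involutive (a ∷ as) {p} (1≤p , p≤n) with p ≤? a
... | yes p≤a = trans (flip-head as (∸-monoʳ-≤ (suc a) 1≤p)) (m∸[m∸n]≡n (m≤n⇒m≤1+n p≤a))
... | no  p≰a = begin
  blockFlip (a ∷ as) (a + q′)       ≡⟨ flip-tail as (head-shift a (proj₁ (blockFlip-range as tail))) ⟩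
  a + blockFlip as (a + q′ ∸ a)     ≡⟨ cong (λ r → a + blockFlip as r) (m+n∸m≡n a q′) ⟩
  a + blockFlip as q′               ≡⟨ cong (a +_) (blockFlip-involutive as tail) ⟩
  a + (p ∸ a)                       ≡⟨ m+[n∸m]≡n (<⇒≤ (≰⇒> p≰a)) ⟩
  p                                 ∎
  where
  tail = tail-range p≰a p≤n
  q′ = blockFlip as (p ∸ a)

revLayered+blockFlip : ∀ c {p} → InRange (sum c) p →
                       revLayered (sum c) c p + blockFlip c p ≡ suc (sum c)
revLayered+blockFlip []       (1≤p , p≤0) = ⊥-elim (<⇒≱ 1≤p p≤0)
revLayered+blockFlip (a ∷ as) {p} (1≤p , p≤n) with p ≤? a
... | yes p≤a = begin
  a + sum as ∸ a + p + (suc a ∸ p)   ≡⟨ cong (λ s → s + p + (suc a ∸ p)) (m+n∸m≡n a (sum as)) ⟩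
  sum as + p + (suc a ∸ p)           ≡⟨ +-assoc (sum as) p _ ⟩
  sum as + (p + (suc a ∸ p))         ≡⟨ cong (sum as +_) (m+[n∸m]≡n (m≤n⇒m≤1+n p≤a)) ⟩
  sum as + suc a                     ≡⟨ +-suc (sum as) a ⟩
  suc (sum as + a)                   ≡⟨ cong suc (+-comm (sum as) a) ⟩
  suc (a + sum as)                   ∎
... | no  p≰a = begin
  revLayered (a + sum as ∸ a) as q + (a + blockFlip as q)
    ≡⟨ cong (λ s → revLayered s as q + (a + blockFlip as q)) (m+n∸m≡n a (sum as)) ⟩
  revLayered (sum as) as q + (a + blockFlip as q)
    ≡⟨ x∙yz≈y∙xz (revLayered (sum as) as q) a (blockFlip as q) ⟩
  a + (revLayered (sum as) as q + blockFlip as q)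
    ≡⟨ cong (a +_) (revLayered+blockFlip as (tail-range p≰a p≤n)) ⟩
  a + suc (sum as)
    ≡⟨ +-suc a (sum as) ⟩
  suc (a + sum as) ∎
  where
  q = p ∸ a


fixed-shift : ∀ a {as q} → FixedPoint (sum as) (blockFlip as) q →
              FixedPoint (sum (a ∷ as)) (blockFlip (a ∷ as)) (a + q)
fixed-shift a {as} {q} ((1≤q , q≤S) , fixed) =
  (≤-trans 1≤q (m≤n+m q a) , +-monoʳ-≤ a q≤S) , (begin
    blockFlip (a ∷ as) (a + q)    ≡⟨ flip-tail as (head-shift a 1≤q) ⟩
    a + blockFlip as (a + q ∸ a)  ≡⟨ cong (λ r → a + blockFlip as r) (m+n∸m≡n a q) ⟩
    a + blockFlip as q            ≡⟨ cong (a +_) fixed ⟩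
    a + q                         ∎)

midpoint-fixed : ∀ h as → FixedPoint (sum (suc (h + h) ∷ as)) (blockFlip (suc (h + h) ∷ as)) (suc h)
midpoint-fixed h as =
  (s≤s z≤n , ≤-trans mid≤a (m≤m+n _ (sum as))) ,
  trans (flip-head as mid≤a) (m+n∸n≡m (suc h) h)
  where
  mid≤a : suc h ≤ suc (h + h)
  mid≤a = s≤s (m≤m+n h h)

odd-midpoint : ∀ {a} as → a % 2 ≡ 1 →
               FixedPoint (sum (a ∷ as)) (blockFlip (a ∷ as)) (suc (a / 2)) × suc (a / 2) ≤ a
odd-midpoint {a} as odd =
  subst (λ b → FixedPoint (sum (b ∷ as)) (blockFlip (b ∷ as)) (suc (a / 2)))
        (sym (odd-decomposition odd)) (midpoint-fixed (a / 2) as) ,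
  subst (suc (a / 2) ≤_) (sym (odd-decomposition odd)) (s≤s (m≤m+n (a / 2) (a / 2)))

midpoints : List ℕ → List ℕ
midpoints []       = []
midpoints (a ∷ as) with even-or-odd a
... | inj₁ _ = map (a +_) (midpoints as)
... | inj₂ _ = suc (a / 2) ∷ map (a +_) (midpoints as)

midpoints-length : ∀ c → length (midpoints c) ≡ oddCount c
midpoints-length []       = refl
midpoints-length (a ∷ as) with even-or-odd a
... | inj₁ even = trans (length-map (a +_) (midpoints as))
                        (trans (midpoints-length as) (sym (oddCount-even a as even)))
... | inj₂ odd  = trans (cong suc (trans (length-map (a +_) (midpoints as)) (midpoints-length as)))
                        (sym (oddCount-odd a as odd))

midpoints-fixed : ∀ c → All (FixedPoint (sum c) (blockFlip c)) (midpoints c)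
midpoints-fixed []       = []
midpoints-fixed (a ∷ as) with even-or-odd a
... | inj₁ _   = All.map⁺ (All.map (fixed-shift a) (midpoints-fixed as))
... | inj₂ odd = proj₁ (odd-midpoint as odd) ∷ All.map⁺ (All.map (fixed-shift a) (midpoints-fixed as))

shift-sorted : ∀ a {qs} → AllPairs _<_ qs → AllPairs _<_ (map (a +_) qs)
shift-sorted a sorted = AllPairs.map⁺ (AllPairs.map (+-monoʳ-< a) sorted)

midpoints-sorted : ∀ c → AllPairs _<_ (midpoints c)
midpoints-sorted []       = []
midpoints-sorted (a ∷ as) with even-or-odd a
... | inj₁ _   = shift-sorted a (midpoints-sorted as)
... | inj₂ odd = All.map⁺ (All.map below (midpoints-fixed as)) ∷ shift-sorted a (midpoints-sorted as)
  where
  below : ∀ {q} → FixedPoint (sum as) (blockFlip as) q → suc (a / 2) < a + q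
  below ((1≤q , _) , _) = ≤-<-trans (proj₂ (odd-midpoint as odd)) (m<m+n a 1≤q)

fixed⇒odd-block : ∀ c {p} → FixedPoint (sum c) (blockFlip c) p → 1 ≤ oddCount c
fixed⇒odd-block []       ((1≤p , p≤0) , _) = ⊥-elim (<⇒≱ 1≤p p≤0)
fixed⇒odd-block (a ∷ as) {p} ((1≤p , p≤n) , fixed) with even-or-odd a
... | inj₂ odd  = subst (1 ≤_) (sym (oddCount-odd a as odd)) (s≤s z≤n)
... | inj₁ even = subst (1 ≤_) (sym (oddCount-even a as even)) (in-tail (p ≤? a))
  where
  in-tail : Dec (p ≤ a) → 1 ≤ oddCount as
  in-tail (yes p≤a) = ⊥-elim (suc-even≢double p even (begin
    suc a              ≡⟨ m∸n+n≡m (m≤n⇒m≤1+n p≤a) ⟨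
    suc a ∸ p + p      ≡⟨ cong (_+ p) (trans (sym (flip-head as p≤a)) fixed) ⟩
    p + p              ∎))
  in-tail (no p≰a) = fixed⇒odd-block as (tail-range p≰a p≤n ,
    +-cancelˡ-≡ a _ _ (trans (sym (flip-tail as p≰a)) (trans fixed (sym (m+[n∸m]≡n (<⇒≤ (≰⇒> p≰a)))))))

length≤1 : ∀ {P : ℕ → Set} {xs} → (∀ {p q} → P p → P q → p < q → ⊥) →
           All P xs → AllPairs _<_ xs → length xs ≤ 1
length≤1 _      []                _                   = z≤n
length≤1 _      (_ ∷ [])          _                   = s≤s z≤n
length≤1 unique (Pp ∷ Pq ∷ _)     ((p<q ∷ _) ∷ _)     = ⊥-elim (unique Pp Pq p<q)

length≤2 : ∀ {P : ℕ → Set} {xs} → (∀ {p q r} → P p → P q → P r → p < q → q < r → ⊥) →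
           All P xs → AllPairs _<_ xs → length xs ≤ 2
length≤2 _     []                  _                                  = z≤n
length≤2 _     (_ ∷ [])            _                                  = s≤s z≤n
length≤2 _     (_ ∷ _ ∷ [])        _                                  = s≤s (s≤s z≤n)
length≤2 three (Pp ∷ Pq ∷ Pr ∷ _) ((p<q ∷ _) ∷ (q<r ∷ _) ∷ _)       = ⊥-elim (three Pp Pq Pr p<q q<r)


iter-+ : ∀ g i j y → iter g (i + j) y ≡ iter g i (iter g j y)
iter-+ g zero    j y = refl
iter-+ g (suc i) j y = cong g (iter-+ g i j y)

module CyclicReflection (n : ℕ) .{{_ : NonZero n}} (f B : ℕ → ℕ)
  (B-range : ∀ {p} → InRange n p → InRange n (B p))
  (B-involutive : ∀ {p} → InRange n p → B (B p) ≡ p)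
  (f+B : ∀ {p} → InRange n p → f p + B p ≡ suc n)
  (cyclic : ∀ j → 1 ≤ j → j ≤ n → ∃ λ k → iter f k 1 ≡ j) where

  f-complement : ∀ {p} → InRange n p → f p ≡ suc n ∸ B p
  f-complement {p} h = trans (sym (m+n∸n≡m (f p) (B p))) (cong (_∸ B p) (f+B h))

  f-range : ∀ {p} → InRange n p → InRange n (f p)
  f-range h with B-range h
  ... | 1≤Bp , Bp≤n rewrite f-complement h = m<n⇒0<n∸m (s≤s Bp≤n) , ∸-monoʳ-≤ (suc n) 1≤Bp

  -- f is injective on {1,…,n}, since B is.
  f-injective : ∀ {p q} → InRange n p → InRange n q → f p ≡ f q → p ≡ q
  f-injective {p} {q} hp hq e = begin
    p          ≡⟨ B-involutive hp ⟨
    B (B p)    ≡⟨ cong B (+-cancelˡ-≡ (f p) _ _ (trans (f+B hp) (trans (sym (f+B hq)) (cong (_+ B q) (sym e))))) ⟩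
    B (B q)    ≡⟨ B-involutive hq ⟩
    q          ∎

  -- B conjugates f to its inverse.
  f-B-f : ∀ {y} → InRange n y → f (B (f y)) ≡ B y
  f-B-f {y} h = begin
    f (B (f y))          ≡⟨ f-complement (B-range (f-range h)) ⟩
    suc n ∸ B (B (f y))  ≡⟨ cong (suc n ∸_) (B-involutive (f-range h)) ⟩
    suc n ∸ f y          ≡⟨ cong (_∸ f y) (f+B h) ⟨
    f y + B y ∸ f y      ≡⟨ m+n∸m≡n (f y) (B y) ⟩
    B y                  ∎

  f≢B : n % 2 ≡ 0 → ∀ {p} → InRange n p → f p ≢ B p
  f≢B even {p} h e = suc-even≢double (B p) even (trans (sym (f+B h)) (cong (_+ B p) e))

  orbit : ℕ → ℕ
  orbit k = iter f k 1

  orbit-range : ∀ k → InRange n (orbit k)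
  orbit-range zero    = s≤s z≤n , >-nonZero⁻¹ n
  orbit-range (suc k) = f-range (orbit-range k)

  orbit-cancel : ∀ t {a b} → orbit (t + a) ≡ orbit (t + b) → orbit a ≡ orbit b
  orbit-cancel zero    e = e
  orbit-cancel (suc t) {a} {b} e = orbit-cancel t (f-injective (orbit-range (t + a)) (orbit-range (t + b)) e)

  orbit-return : ∀ {a b} → a ≤ b → orbit a ≡ orbit b → orbit (b ∸ a) ≡ 1
  orbit-return {a} {b} a≤b e =
    sym (orbit-cancel a (trans (cong orbit (+-identityʳ a)) (trans e (cong orbit (sym (m+[n∸m]≡n a≤b))))))

  orbit-periodic : ∀ {d} → orbit d ≡ 1 → ∀ q t → orbit (t + q * d) ≡ orbit t
  orbit-periodic e zero    t = cong orbit (+-identityʳ t)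
  orbit-periodic {d} e (suc q) t = begin
    orbit (t + (d + q * d))       ≡⟨ cong orbit (x∙yz≈y∙xz t d (q * d)) ⟩
    orbit (d + (t + q * d))       ≡⟨ cong orbit (+-comm d (t + q * d)) ⟩
    orbit (t + q * d + d)         ≡⟨ iter-+ f (t + q * d) d 1 ⟩
    iter f (t + q * d) (orbit d)  ≡⟨ cong (iter f (t + q * d)) e ⟩
    orbit (t + q * d)             ≡⟨ orbit-periodic e q t ⟩
    orbit t                       ∎

  orbit-mod : ∀ d .{{_ : NonZero d}} → orbit d ≡ 1 → ∀ k → orbit k ≡ orbit (k % d)
  orbit-mod d e k = trans (cong orbit (m≡m%n+[m/n]*n k d)) (orbit-periodic e (k / d) (k % d))

  index : ∀ {p} → InRange n p → ℕ
  index (1≤p , p≤n) = proj₁ (cyclic _ 1≤p p≤n)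

  index-hits : ∀ {p} (h : InRange n p) → orbit (index h) ≡ p
  index-hits (1≤p , p≤n) = proj₂ (cyclic _ 1≤p p≤n)

  point : (j : Fin n) → InRange n (suc (toℕ j))
  point j = s≤s z≤n , toℕ<n j

  index-of : Fin n → ℕ
  index-of j = index (point j)

  -- The orbit cannot return to 1 before visiting all n points: otherwise
  -- it would take fewer than n values.
  no-early-return : ∀ {d} → 0 < d → d < n → orbit d ≡ 1 → ⊥
  no-early-return {d@(suc _)} _ d<n returns
    with pigeonhole d<n (λ j → fromℕ< (m%n<n (index-of j) d))
  ... | i , j , i<j , same = <⇒≢ i<j (suc-injective (begin
    suc (toℕ i)            ≡⟨ index-hits (point i) ⟨
    orbit (index-of i)     ≡⟨ orbit-mod d returns (index-of i) ⟩
    orbit (index-of i % d) ≡⟨ cong orbit (fromℕ<-injective _ _ _ _ same) ⟩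
    orbit (index-of j % d) ≡⟨ orbit-mod d returns (index-of j) ⟨
    orbit (index-of j)     ≡⟨ index-hits (point j) ⟩
    suc (toℕ j)            ∎))

  pred< : ∀ {p} → InRange n p → pred p < n
  pred< (s≤s z≤n , p≤n) = p≤n

  pred-cancel : ∀ {p q} → InRange n p → InRange n q → pred p ≡ pred q → p ≡ q
  pred-cancel (s≤s z≤n , _) (s≤s z≤n , _) e = cong suc e

  -- Among the first n + 1 orbit points two coincide, so the orbit returns
  -- to 1 within n steps.
  early-recurrence : ∃ λ d → 0 < d × d ≤ n × orbit d ≡ 1
  early-recurrence with pigeonhole (n<1+n n) (λ i → fromℕ< (pred< (orbit-range (toℕ i))))
  ... | i , j , i<j , same =
    toℕ j ∸ toℕ i , m<n⇒0<n∸m i<j , ≤-trans (m∸n≤m (toℕ j) (toℕ i)) (≤-pred (toℕ<n j)) ,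
    orbit-return (<⇒≤ i<j) (pred-cancel (orbit-range (toℕ i)) (orbit-range (toℕ j)) (fromℕ<-injective _ _ _ _ same))

  orbit-period : orbit n ≡ 1
  orbit-period with early-recurrence
  ... | d , 0<d , d≤n , returns with m≤n⇒m<n∨m≡n d≤n
  ...   | inj₁ d<n  = ⊥-elim (no-early-return 0<d d<n returns)
  ...   | inj₂ refl = returns

  return-time : ∀ {d} → 0 < d → d < n + n → orbit d ≡ 1 → d ≡ n
  return-time {d} 0<d d<2n returns with <-cmp d n
  ... | tri< d<n _ _ = ⊥-elim (no-early-return 0<d d<n returns)
  ... | tri≈ _ d≡n _ = d≡n
  ... | tri> _ _ n<d = ⊥-elim (no-early-return (m<n⇒0<n∸m n<d) (m<n+o⇒m∸n<o d n d<2n)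
                          (orbit-return (<⇒≤ n<d) (trans orbit-period (sym returns))))

  orbit-index : ∀ {p} → InRange n p → ∃ λ k → k < n × orbit k ≡ p
  orbit-index h = index h % n , m%n<n (index h) n ,
                  trans (sym (orbit-mod n orbit-period (index h))) (index-hits h)

  c₀ : ℕ
  c₀ = proj₁ (orbit-index (B-range (orbit-range 0)))

  orbit-c₀ : orbit c₀ ≡ B 1
  orbit-c₀ = proj₂ (proj₂ (orbit-index (B-range (orbit-range 0))))

  reflection-index : ∀ k {j} → B (orbit k) ≡ orbit j → orbit (k + j) ≡ orbit c₀
  reflection-index zero    e = trans (sym e) (sym orbit-c₀)
  reflection-index (suc k) {j} e = trans (cong orbit (sym (+-suc k j))) (reflection-index k (begin
    B (orbit k)            ≡⟨ f-B-f (orbit-range k) ⟨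
    f (B (orbit (suc k)))  ≡⟨ cong f e ⟩
    orbit (suc j)          ∎))

  fixed-index : ∀ {p} → FixedPoint n B p → ∃ λ k → k < n × orbit k ≡ p × orbit (k + k) ≡ orbit c₀
  fixed-index (h , fixed) with orbit-index h
  ... | k , k<n , refl = k , k<n , refl , reflection-index k fixed

  record Antipodal (i j : ℕ) : Set where
    constructor half-turn
    field doubled : i + i + n ≡ j + j

  -- If x_(2i) = x_(2j) with i < j < n, then 2j - 2i is a return time below
  -- 2n, hence equal to n.
  antipodal-< : ∀ {i j} → i < j → j < n → orbit (i + i) ≡ orbit (j + j) → Antipodal i j
  antipodal-< {i} {j} i<j j<n e = half-turn $ begin
    i + i + n                  ≡⟨ cong (i + i +_) gap≡n ⟨
    i + i + (j + j ∸ (i + i))  ≡⟨ m+[n∸m]≡n (<⇒≤ 2i<2j) ⟩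
    j + j                      ∎
    where
    2i<2j : i + i < j + j
    2i<2j = +-mono-< i<j i<j
    gap≡n : j + j ∸ (i + i) ≡ n
    gap≡n = return-time (m<n⇒0<n∸m 2i<2j) (≤-<-trans (m∸n≤m (j + j) (i + i)) (+-mono-< j<n j<n))
                        (orbit-return (<⇒≤ 2i<2j) e)

  antipodal : ∀ {i j} → i < n → j < n → orbit i ≢ orbit j → orbit (i + i) ≡ orbit (j + j) →
              Antipodal i j ⊎ Antipodal j i
  antipodal {i} {j} i<n j<n distinct e with <-cmp i j
  ... | tri< i<j _ _ = inj₁ (antipodal-< i<j j<n e)
  ... | tri≈ _ i≡j _ = ⊥-elim (distinct (cong orbit i≡j))
  ... | tri> _ _ j<i = inj₂ (antipodal-< j<i i<n (sym e))

  -- Two half turns make a full turn, which is too far for an index below n.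
  no-antipodal-chain : ∀ {i j k} → Antipodal i j → Antipodal j k → k < n → ⊥
  no-antipodal-chain {i} {j} {k} (half-turn ij) (half-turn jk) k<n =
    <⇒≱ (+-mono-< k<n k<n) (subst (n + n ≤_) (trans (cong (_+ n) ij) jk) (+-monoˡ-≤ n (m≤n+m n (i + i))))

  antipodal⇒even : ∀ {i j} → Antipodal i j → n % 2 ≡ 0
  antipodal⇒even {i} {j} (half-turn ij) = begin
    n % 2              ≡⟨ [m+kn]%n≡m%n n i 2 ⟨
    (n + i * 2) % 2    ≡⟨ cong (λ m → (n + m) % 2) (double≡*2 i) ⟨
    (n + (i + i)) % 2  ≡⟨ cong (_% 2) (trans (+-comm n (i + i)) ij) ⟩
    (j + j) % 2        ≡⟨ double%2 j ⟩
    0                  ∎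

  odd⇒unique-fixed : n % 2 ≡ 1 → ∀ {p q} → FixedPoint n B p → FixedPoint n B q → p < q → ⊥
  odd⇒unique-fixed odd fp fq p<q with fixed-index fp | fixed-index fq
  ... | i , i<n , refl , di | j , j<n , refl , dj
        with antipodal i<n j<n (<⇒≢ p<q) (trans di (sym dj))
  ...   | inj₁ ij = 0≢1+n (trans (sym (antipodal⇒even ij)) odd)
  ...   | inj₂ ji = 0≢1+n (trans (sym (antipodal⇒even ji)) odd)

  -- B never has three fixed points: their indices would be pairwise antipodal.
  no-three-fixed : ∀ {p q r} → FixedPoint n B p → FixedPoint n B q → FixedPoint n B r → p < q → q < r → ⊥
  no-three-fixed fp fq fr p<q q<r with fixed-index fp | fixed-index fq | fixed-index fr
  ... | i , i<n , refl , di | j , j<n , refl , dj | k , k<n , refl , dk =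
    tournament (antipodal i<n j<n (<⇒≢ p<q) (trans di (sym dj)))
               (antipodal i<n k<n (<⇒≢ (<-trans p<q q<r)) (trans di (sym dk)))
               (antipodal j<n k<n (<⇒≢ q<r) (trans dj (sym dk)))
    where
    -- Any orientation of the three pairs contains a chain of two half turns.
    tournament : Antipodal i j ⊎ Antipodal j i → Antipodal i k ⊎ Antipodal k i →
                 Antipodal j k ⊎ Antipodal k j → ⊥
    tournament (inj₁ ij) (inj₁ ik) (inj₁ jk) = no-antipodal-chain ij jk k<n
    tournament (inj₁ ij) (inj₁ ik) (inj₂ kj) = no-antipodal-chain ik kj j<n
    tournament (inj₁ ij) (inj₂ ki) _         = no-antipodal-chain ki ij j<n
    tournament (inj₂ ji) (inj₁ ik) _         = no-antipodal-chain ji ik k<n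
    tournament (inj₂ ji) (inj₂ ki) (inj₁ jk) = no-antipodal-chain jk ki i<n
    tournament (inj₂ ji) (inj₂ ki) (inj₂ kj) = no-antipodal-chain kj ji i<n

  reflect-along : ∀ k {i} → c₀ ≡ k + i → B (orbit k) ≡ orbit i
  reflect-along k {i} c₀≡k+i =
    trans (sym hits) (orbit-cancel k {j} {i} (trans (reflection-index k (sym hits)) (cong orbit c₀≡k+i)))
    where
    j = index (B-range (orbit-range k))
    hits = index-hits (B-range (orbit-range k))

  -- For n even, c₀ = 2k gives the fixed point xₖ, while c₀ = 2k + 1 would
  -- give f xₖ = B xₖ.
  even⇒fixed-point : n % 2 ≡ 0 → ∃ (FixedPoint n B)
  even⇒fixed-point even with halve c₀
  ... | k , inj₁ c₀≡2k   = orbit k , orbit-range k , reflect-along k c₀≡2k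
  ... | k , inj₂ c₀≡2k+1 =
    ⊥-elim (f≢B even (orbit-range k) (sym (reflect-along k (trans c₀≡2k+1 (sym (+-suc k k))))))


proposition4p8 : (n : ℕ) → 0 < n → (c : List ℕ) → All (0 <_) c → sum c ≡ n →
    Cyclic n c → (n % 2 ≡ 1 → oddCount c ≡ 1) × (n % 2 ≡ 0 → oddCount c ≡ 2)
proposition4p8 .(sum c) 0<n c _ refl cyclic = odd-case , even-case
  where
  open CyclicReflection (sum c) {{>-nonZero 0<n}} (revLayered (sum c) c) (blockFlip c)
    (blockFlip-range c) (blockFlip-involutive c) (revLayered+blockFlip c) cyclic

  count-parity : oddCount c % 2 ≡ sum c % 2
  count-parity = sym (sum-parity c)

  counted : ∀ {b} → length (midpoints c) ≤ b → oddCount c ≤ b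
  counted = subst (_≤ _) (midpoints-length c)

  odd-case : sum c % 2 ≡ 1 → oddCount c ≡ 1
  odd-case odd = small-odd
    (counted (length≤1 (odd⇒unique-fixed odd) (midpoints-fixed c) (midpoints-sorted c)))
    (trans count-parity odd)

  even-case : sum c % 2 ≡ 0 → oddCount c ≡ 2
  even-case even = small-even
    (fixed⇒odd-block c (proj₂ (even⇒fixed-point even)))
    (counted (length≤2 no-three-fixed (midpoints-fixed c) (midpoints-sorted c)))
    (trans count-parity even)
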